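{- Let $A$ be a pseudo-hoop and let $F$ be a normal filter of $A$. Then $F$ is a fantastic filter of $A$ if and only if the quotient $A/F$ is a Wajsberg pseudo-hoop.
   Context: A pseudo-hoop is an algebra $(A,\odot,\rightarrow,\rightsquigarrow,1)$ of type $(2,2,2,0)$ such that for all $x,y,z\in A$: $x\odot 1=1\odot x=x$; $x\rightarrow x=x\rightsquigarrow x=1$; $(x\odot y)\rightarrow z=x\rightarrow(y\rightarrow z)$; $(x\odot y)\rightsquigarrow z=y\rightsquigarrow(x\rightsquigarrow z)$; $(x\rightarrow y)\odot x=(y\rightarrow x)\odot y=x\odot(x\rightsquigarrow y)=y\odot(y\rightsquigarrow x)$. The order is $x\le y$ iff $x\rightarrow y=1$. Put $x\vee_1 y=(x\rightarrow y)\rightsquigarrow y$, $x\vee_2 y=(x\rightsquigarrow y)\rightarrow y$. $A$ is Wajsberg if $x\vee_1 y=y\vee_1 x$ and $x\vee_2 y=y\vee_2 x$ for all $x,y$. A filter is a nonempty $F\subseteq A$ closed under $\odot$ and upward closed; it is normal if for all $x,y$: $x\rightarrow y\in F$ iff $x\rightsquigarrow y\in F$; it is fantastic if for all $x,y\in A$: $y\rightarrow x\in F$ implies $x\vee_1 y\rightarrow x\in F$, and $y\rightsquigarrow x\in F$ implies $x\vee_2 y\rightsquigarrow x\in F$. For a normal filter $F$, the relation $(x,y)\in\Theta_F$ iff $x\rightarrow y\in F$ and $y\rightarrow x\in F$ is a congruence, and $A/F$ is the quotient pseudo-hoop $A/\Theta_F$. -}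

module Defs where

open import Level using (Level; suc; _⊔_)
open import Data.Product using (_×_; ∃)
open import Relation.Binary.PropositionalEquality using (_≡_)

-- A pseudo-hoop (A, ⊙, →, ⇝, 1); the arrow → is written _⇒_ here.
record PseudoHoop (c : Level) : Set (suc c) where
  infixl 7 _⊙_
  infixr 5 _⇒_ _⇝_
  field
    Carrier : Set c
    _⊙_ : Carrier → Carrier → Carrier
    _⇒_ : Carrier → Carrier → Carrier
    _⇝_ : Carrier → Carrier → Carrier
    𝟙   : Carrier
    ⊙-identityʳ : ∀ x → x ⊙ 𝟙 ≡ x
    ⊙-identityˡ : ∀ x → 𝟙 ⊙ x ≡ x
    ⇒-refl : ∀ x → x ⇒ x ≡ 𝟙
    ⇝-refl : ∀ x → x ⇝ x ≡ 𝟙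
    ⊙-⇒ : ∀ x y z → (x ⊙ y) ⇒ z ≡ x ⇒ (y ⇒ z)
    ⊙-⇝ : ∀ x y z → (x ⊙ y) ⇝ z ≡ y ⇝ (x ⇝ z)
    div₁ : ∀ x y → (x ⇒ y) ⊙ x ≡ (y ⇒ x) ⊙ y
    div₂ : ∀ x y → (y ⇒ x) ⊙ y ≡ x ⊙ (x ⇝ y)
    div₃ : ∀ x y → x ⊙ (x ⇝ y) ≡ y ⊙ (y ⇝ x)

  _≤_ : Carrier → Carrier → Set c
  x ≤ y = x ⇒ y ≡ 𝟙

  _∨₁_ : Carrier → Carrier → Carrier
  x ∨₁ y = (x ⇒ y) ⇝ y

  _∨₂_ : Carrier → Carrier → Carrier
  x ∨₂ y = (x ⇝ y) ⇒ y

module _ {c : Level} (A : PseudoHoop c) where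
  open PseudoHoop A

  Subset : Set (suc c)
  Subset = Carrier → Set c

  record IsFilter (F : Subset) : Set c where
    field
      nonempty : ∃ λ x → F x
      ⊙-closed : ∀ {x y} → F x → F y → F (x ⊙ y)
      up-closed : ∀ {x y} → F x → x ≤ y → F y

  IsNormal : Subset → Set c
  IsNormal F = ∀ x y → (F (x ⇒ y) → F (x ⇝ y)) × (F (x ⇝ y) → F (x ⇒ y))

  IsFantastic : Subset → Set c
  IsFantastic F =
    (∀ x y → F (y ⇒ x) → F ((x ∨₁ y) ⇒ x)) ×
    (∀ x y → F (y ⇝ x) → F ((x ∨₂ y) ⇝ x))

  Θ : Subset → Carrier → Carrier → Set c
  Θ F x y = F (x ⇒ y) × F (y ⇒ x)

  -- A/F is Wajsberg: in the quotient A/Θ_F (same operations, equality Θ_F),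
  -- x ∨₁ y = y ∨₁ x and x ∨₂ y = y ∨₂ x for all classes, i.e. for all
  -- representatives x, y.
  QuotientIsWajsberg : Subset → Set c
  QuotientIsWajsberg F =
    (∀ x y → Θ F (x ∨₁ y) (y ∨₁ x)) × (∀ x y → Θ F (x ∨₂ y) (y ∨₂ x))

-- Both joins are upper bounds and are monotone in their first argument. If F is
-- fantastic, applying fantasticity to the pair (y ∨₁ x, y), legitimate since
-- y ≤ y ∨₁ x, bounds x ∨₁ y by y ∨₁ x modulo F. Conversely, if y → x ∈ F then
-- (y ∨₁ x) → x = (y → x) ∨₂ x ∈ F as well, so commutativity of ∨₁ modulo F and
-- transitivity of → inside F give (x ∨₁ y) → x ∈ F. The ⇝ halves are symmetric,
-- normality moving between → and ⇝ inside F.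
module Submission where

open import Defs
open import Level using (Level)
open import Data.Product using (_×_; _,_; proj₁; proj₂)
open import Relation.Binary.PropositionalEquality
open ≡-Reasoning

module PseudoHoopProperties {c : Level} (A : PseudoHoop c) where
  open PseudoHoop A

  ≤⇒⇝≡𝟙 : ∀ {x y} → x ≤ y → x ⇝ y ≡ 𝟙
  ≤⇒⇝≡𝟙 {x} {y} x≤y = begin
    x ⇝ y                 ≡⟨ cong (_⇝ y) (sym x⊙[x⇝y]≡x) ⟩
    (x ⊙ (x ⇝ y)) ⇝ y     ≡⟨ ⊙-⇝ x (x ⇝ y) y ⟩
    (x ⇝ y) ⇝ (x ⇝ y)     ≡⟨ ⇝-refl _ ⟩
    𝟙                     ∎
    where
    x⊙[x⇝y]≡x : x ⊙ (x ⇝ y) ≡ x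
    x⊙[x⇝y]≡x = begin
      x ⊙ (x ⇝ y)     ≡⟨ sym (trans (div₁ x y) (div₂ x y)) ⟩
      (x ⇒ y) ⊙ x     ≡⟨ cong (_⊙ x) x≤y ⟩
      𝟙 ⊙ x           ≡⟨ ⊙-identityˡ x ⟩
      x               ∎

  ⇝≡𝟙⇒≤ : ∀ {x y} → x ⇝ y ≡ 𝟙 → x ≤ y
  ⇝≡𝟙⇒≤ {x} {y} x⇝y≡𝟙 = begin
    x ⇒ y                 ≡⟨ cong (_⇒ y) (sym [x⇒y]⊙x≡x) ⟩
    ((x ⇒ y) ⊙ x) ⇒ y     ≡⟨ ⊙-⇒ (x ⇒ y) x y ⟩
    (x ⇒ y) ⇒ (x ⇒ y)     ≡⟨ ⇒-refl _ ⟩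
    𝟙                     ∎
    where
    [x⇒y]⊙x≡x : (x ⇒ y) ⊙ x ≡ x
    [x⇒y]⊙x≡x = begin
      (x ⇒ y) ⊙ x     ≡⟨ trans (div₁ x y) (div₂ x y) ⟩
      x ⊙ (x ⇝ y)     ≡⟨ cong (x ⊙_) x⇝y≡𝟙 ⟩
      x ⊙ 𝟙           ≡⟨ ⊙-identityʳ x ⟩
      x               ∎

  ≤-antisym : ∀ {x y} → x ≤ y → y ≤ x → x ≡ y
  ≤-antisym {x} {y} x≤y y≤x = begin
    x               ≡⟨ sym (⊙-identityˡ x) ⟩
    𝟙 ⊙ x           ≡⟨ cong (_⊙ x) (sym x≤y) ⟩
    (x ⇒ y) ⊙ x     ≡⟨ div₁ x y ⟩
    (y ⇒ x) ⊙ y     ≡⟨ cong (_⊙ y) y≤x ⟩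
    𝟙 ⊙ y           ≡⟨ ⊙-identityˡ y ⟩
    y               ∎

  ⇒-identityˡ : ∀ x → 𝟙 ⇒ x ≡ x
  ⇒-identityˡ x = ≤-antisym [𝟙⇒x]≤x x≤[𝟙⇒x]
    where
    [𝟙⇒x]≤x : (𝟙 ⇒ x) ≤ x
    [𝟙⇒x]≤x = begin
      (𝟙 ⇒ x) ⇒ x             ≡⟨ cong (_⇒ x) (sym (⊙-identityʳ (𝟙 ⇒ x))) ⟩
      ((𝟙 ⇒ x) ⊙ 𝟙) ⇒ x       ≡⟨ ⊙-⇒ (𝟙 ⇒ x) 𝟙 x ⟩
      (𝟙 ⇒ x) ⇒ (𝟙 ⇒ x)       ≡⟨ ⇒-refl _ ⟩
      𝟙                       ∎
    x≤[𝟙⇒x] : x ≤ (𝟙 ⇒ x)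
    x≤[𝟙⇒x] = begin
      x ⇒ (𝟙 ⇒ x)     ≡⟨ sym (⊙-⇒ x 𝟙 x) ⟩
      (x ⊙ 𝟙) ⇒ x     ≡⟨ cong (_⇒ x) (⊙-identityʳ x) ⟩
      x ⇒ x           ≡⟨ ⇒-refl x ⟩
      𝟙               ∎

  x≤𝟙 : ∀ x → x ≤ 𝟙
  x≤𝟙 x = begin
    x ⇒ 𝟙                   ≡⟨ cong (_⇒ 𝟙) (sym [x⇒𝟙]⊙x≡x) ⟩
    ((x ⇒ 𝟙) ⊙ x) ⇒ 𝟙       ≡⟨ ⊙-⇒ (x ⇒ 𝟙) x 𝟙 ⟩
    (x ⇒ 𝟙) ⇒ (x ⇒ 𝟙)       ≡⟨ ⇒-refl _ ⟩
    𝟙                       ∎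
    where
    [x⇒𝟙]⊙x≡x : (x ⇒ 𝟙) ⊙ x ≡ x
    [x⇒𝟙]⊙x≡x = trans (div₁ x 𝟙) (trans (⊙-identityʳ _) (⇒-identityˡ x))

  x⊙y≤y : ∀ x y → (x ⊙ y) ≤ y
  x⊙y≤y x y = begin
    (x ⊙ y) ⇒ y     ≡⟨ ⊙-⇒ x y y ⟩
    x ⇒ (y ⇒ y)     ≡⟨ cong (x ⇒_) (⇒-refl y) ⟩
    x ⇒ 𝟙           ≡⟨ x≤𝟙 x ⟩
    𝟙               ∎

  x⊙y≤x : ∀ x y → (x ⊙ y) ≤ x
  x⊙y≤x x y = ⇝≡𝟙⇒≤ (begin
    (x ⊙ y) ⇝ x     ≡⟨ ⊙-⇝ x y x ⟩
    y ⇝ (x ⇝ x)     ≡⟨ cong (y ⇝_) (⇝-refl x) ⟩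
    y ⇝ 𝟙           ≡⟨ ≤⇒⇝≡𝟙 (x≤𝟙 y) ⟩
    𝟙               ∎)

  ⇒-mp : ∀ x y → ((x ⇒ y) ⊙ x) ≤ y
  ⇒-mp x y = trans (⊙-⇒ (x ⇒ y) x y) (⇒-refl _)

  ⇝-mp : ∀ x y → (x ⊙ (x ⇝ y)) ≤ y
  ⇝-mp x y = ⇝≡𝟙⇒≤ (trans (⊙-⇝ x (x ⇝ y) y) (⇝-refl _))

  ⊙-≤-residualʳ : ∀ {x y z} → (x ⊙ y) ≤ z → x ≤ (y ⇒ z)
  ⊙-≤-residualʳ {x} {y} {z} x⊙y≤z = trans (sym (⊙-⇒ x y z)) x⊙y≤z

  ⊙-≤-residualˡ : ∀ {x y z} → (x ⊙ y) ≤ z → y ≤ (x ⇝ z)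
  ⊙-≤-residualˡ {x} {y} {z} x⊙y≤z =
    ⇝≡𝟙⇒≤ (trans (sym (⊙-⇝ x y z)) (≤⇒⇝≡𝟙 x⊙y≤z))

  -- Below x ≤ y, x factors through y as (y → x) ⊙ y and as y ⊙ (y ⇝ x); the
  -- residuation laws then reduce antitonicity to x ⊙ y ≤ x, resp. x ⊙ y ≤ y.
  ⇒-antitoneˡ : ∀ {x y} z → x ≤ y → (y ⇒ z) ≤ (x ⇒ z)
  ⇒-antitoneˡ {x} {y} z x≤y = begin
    (y ⇒ z) ⇒ (x ⇒ z)                     ≡⟨ cong (λ u → (y ⇒ z) ⇒ (u ⇒ z)) x≡[y⇒x]⊙y ⟩
    (y ⇒ z) ⇒ (((y ⇒ x) ⊙ y) ⇒ z)         ≡⟨ cong ((y ⇒ z) ⇒_) (⊙-⇒ (y ⇒ x) y z) ⟩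
    (y ⇒ z) ⇒ ((y ⇒ x) ⇒ (y ⇒ z))         ≡⟨ sym (⊙-⇒ (y ⇒ z) (y ⇒ x) (y ⇒ z)) ⟩
    ((y ⇒ z) ⊙ (y ⇒ x)) ⇒ (y ⇒ z)         ≡⟨ x⊙y≤x (y ⇒ z) (y ⇒ x) ⟩
    𝟙                                     ∎
    where
    x≡[y⇒x]⊙y : x ≡ (y ⇒ x) ⊙ y
    x≡[y⇒x]⊙y = trans (sym (⊙-identityˡ x)) (trans (cong (_⊙ x) (sym x≤y)) (div₁ x y))

  ⇝-antitoneˡ : ∀ {x y} z → x ≤ y → (y ⇝ z) ≤ (x ⇝ z)
  ⇝-antitoneˡ {x} {y} z x≤y = ⇝≡𝟙⇒≤ (begin
    (y ⇝ z) ⇝ (x ⇝ z)                     ≡⟨ cong (λ u → (y ⇝ z) ⇝ (u ⇝ z)) x≡y⊙[y⇝x] ⟩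
    (y ⇝ z) ⇝ ((y ⊙ (y ⇝ x)) ⇝ z)         ≡⟨ cong ((y ⇝ z) ⇝_) (⊙-⇝ y (y ⇝ x) z) ⟩
    (y ⇝ z) ⇝ ((y ⇝ x) ⇝ (y ⇝ z))         ≡⟨ sym (⊙-⇝ (y ⇝ x) (y ⇝ z) (y ⇝ z)) ⟩
    ((y ⇝ x) ⊙ (y ⇝ z)) ⇝ (y ⇝ z)         ≡⟨ ≤⇒⇝≡𝟙 (x⊙y≤y (y ⇝ x) (y ⇝ z)) ⟩
    𝟙                                     ∎)
    where
    x≡y⊙[y⇝x] : x ≡ y ⊙ (y ⇝ x)
    x≡y⊙[y⇝x] = begin
      x               ≡⟨ sym (⊙-identityˡ x) ⟩
      𝟙 ⊙ x           ≡⟨ cong (_⊙ x) (sym x≤y) ⟩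
      (x ⇒ y) ⊙ x     ≡⟨ div₁ x y ⟩
      (y ⇒ x) ⊙ y     ≡⟨ div₂ x y ⟩
      x ⊙ (x ⇝ y)     ≡⟨ div₃ x y ⟩
      y ⊙ (y ⇝ x)     ∎

  ∨₁-monoˡ : ∀ {x y} z → x ≤ y → (x ∨₁ z) ≤ (y ∨₁ z)
  ∨₁-monoˡ z x≤y = ⇝-antitoneˡ z (⇒-antitoneˡ z x≤y)

  ∨₂-monoˡ : ∀ {x y} z → x ≤ y → (x ∨₂ z) ≤ (y ∨₂ z)
  ∨₂-monoˡ z x≤y = ⇒-antitoneˡ z (⇝-antitoneˡ z x≤y)

  x≤x∨₁y : ∀ x y → x ≤ (x ∨₁ y)
  x≤x∨₁y x y = ⊙-≤-residualˡ (⇒-mp x y)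

  y≤x∨₁y : ∀ x y → y ≤ (x ∨₁ y)
  y≤x∨₁y x y = ⊙-≤-residualˡ (x⊙y≤y (x ⇒ y) y)

  x≤x∨₂y : ∀ x y → x ≤ (x ∨₂ y)
  x≤x∨₂y x y = ⊙-≤-residualʳ (⇝-mp x y)

  y≤x∨₂y : ∀ x y → y ≤ (x ∨₂ y)
  y≤x∨₂y x y = ⊙-≤-residualʳ (x⊙y≤x y (x ⇝ y))

  ⇒-≤-compose : ∀ x y z → (y ⇒ z) ≤ ((x ⇒ y) ⇒ (x ⇒ z))
  ⇒-≤-compose x y z =
    subst ((y ⇒ z) ≤_) (⊙-⇒ (x ⇒ y) x z) (⇒-antitoneˡ z (⇒-mp x y))

module FilterProperties {c : Level} (A : PseudoHoop c)
                        {F : Subset A} (isFilter : IsFilter A F) where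
  open PseudoHoop A
  open PseudoHoopProperties A
  open IsFilter isFilter

  𝟙∈F : F 𝟙
  𝟙∈F = up-closed (proj₂ nonempty) (x≤𝟙 _)

  ≤⇒⇒∈F : ∀ {x y} → x ≤ y → F (x ⇒ y)
  ≤⇒⇒∈F x≤y = subst F (sym x≤y) 𝟙∈F

  ≤⇒⇝∈F : ∀ {x y} → x ≤ y → F (x ⇝ y)
  ≤⇒⇝∈F x≤y = subst F (sym (≤⇒⇝≡𝟙 x≤y)) 𝟙∈F

  ⇒-mp-∈F : ∀ {x y} → F x → F (x ⇒ y) → F y
  ⇒-mp-∈F {x} {y} x∈F x⇒y∈F = up-closed (⊙-closed x⇒y∈F x∈F) (⇒-mp x y)

  ⇒-trans-∈F : ∀ {x y z} → F (x ⇒ y) → F (y ⇒ z) → F (x ⇒ z)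
  ⇒-trans-∈F {x} {y} {z} x⇒y∈F y⇒z∈F =
    ⇒-mp-∈F x⇒y∈F (up-closed y⇒z∈F (⇒-≤-compose x y z))

module FantasticCharacterisation {c : Level} (A : PseudoHoop c) {F : Subset A}
                                 (isFilter : IsFilter A F) (normal : IsNormal A F) where
  open PseudoHoop A
  open PseudoHoopProperties A
  open FilterProperties A isFilter
  open IsFilter isFilter

  ⇝∈F⇒⇒∈F : ∀ {x y} → F (x ⇝ y) → F (x ⇒ y)
  ⇝∈F⇒⇒∈F = proj₂ (normal _ _)

  ⇒∈F⇒⇝∈F : ∀ {x y} → F (x ⇒ y) → F (x ⇝ y)
  ⇒∈F⇒⇝∈F = proj₁ (normal _ _)

  fantastic₁⇒∨₁-comm : (∀ x y → F (y ⇒ x) → F ((x ∨₁ y) ⇒ x)) →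
                       ∀ x y → F ((x ∨₁ y) ⇒ (y ∨₁ x))
  fantastic₁⇒∨₁-comm fantastic₁ x y =
    up-closed (fantastic₁ (y ∨₁ x) y (≤⇒⇒∈F (x≤x∨₁y y x)))
              (⇒-antitoneˡ (y ∨₁ x) (∨₁-monoˡ y (y≤x∨₁y y x)))

  fantastic₂⇒∨₂-comm : (∀ x y → F (y ⇝ x) → F ((x ∨₂ y) ⇝ x)) →
                       ∀ x y → F ((x ∨₂ y) ⇒ (y ∨₂ x))
  fantastic₂⇒∨₂-comm fantastic₂ x y =
    up-closed (⇝∈F⇒⇒∈F (fantastic₂ (y ∨₂ x) y (≤⇒⇝∈F (x≤x∨₂y y x))))
              (⇒-antitoneˡ (y ∨₂ x) (∨₂-monoˡ y (y≤x∨₂y y x)))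

  ∨₁-comm⇒fantastic₁ : (∀ x y → F ((x ∨₁ y) ⇒ (y ∨₁ x))) →
                       ∀ x y → F (y ⇒ x) → F ((x ∨₁ y) ⇒ x)
  ∨₁-comm⇒fantastic₁ comm x y y⇒x∈F =
    ⇒-trans-∈F (comm x y) (up-closed y⇒x∈F (x≤x∨₂y (y ⇒ x) x))

  ∨₂-comm⇒fantastic₂ : (∀ x y → F ((x ∨₂ y) ⇒ (y ∨₂ x))) →
                       ∀ x y → F (y ⇝ x) → F ((x ∨₂ y) ⇝ x)
  ∨₂-comm⇒fantastic₂ comm x y y⇝x∈F =
    ⇒∈F⇒⇝∈F (⇒-trans-∈F (comm x y)
                         (⇝∈F⇒⇒∈F (up-closed y⇝x∈F (x≤x∨₁y (y ⇝ x) x))))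

theorem4p20 : {c : Level} (A : PseudoHoop c) (F : Subset A) →
    IsFilter A F → IsNormal A F →
    (IsFantastic A F → QuotientIsWajsberg A F) × (QuotientIsWajsberg A F → IsFantastic A F)
theorem4p20 A F isFilter normal = fantastic⇒wajsberg , wajsberg⇒fantastic
  where
  open FantasticCharacterisation A isFilter normal

  fantastic⇒wajsberg : IsFantastic A F → QuotientIsWajsberg A F
  fantastic⇒wajsberg (fantastic₁ , fantastic₂) =
      (λ x y → fantastic₁⇒∨₁-comm fantastic₁ x y , fantastic₁⇒∨₁-comm fantastic₁ y x)
    , (λ x y → fantastic₂⇒∨₂-comm fantastic₂ x y , fantastic₂⇒∨₂-comm fantastic₂ y x)

  wajsberg⇒fantastic : QuotientIsWajsberg A F → IsFantastic A F
  wajsberg⇒fantastic (wajsberg₁ , wajsberg₂) =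
      ∨₁-comm⇒fantastic₁ (λ x y → proj₁ (wajsberg₁ x y))
    , ∨₂-comm⇒fantastic₂ (λ x y → proj₁ (wajsberg₂ x y))
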